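{- For every integer $n\ge 6$ and every vertex $v$ of the Kneser graph $K(n,2)$, $\Pi_v^v(K(n,2))\cong\mathbb{Z}/2$.
   Context: The Kneser graph $K(n,2)$ is the loopless graph whose vertices are the $2$-element subsets of $\{1,\dots,n\}$, two vertices being adjacent iff the subsets are disjoint. A walk is a sequence $(v_0\cdots v_m)$ with $v_i\sim v_{i+1}$. A prune of a walk with $v_i=v_{i+2}$ replaces the segment $v_iv_{i+1}v_i$ by $v_i$; a spider move on $(v_0\cdots v_m)$ replaces one vertex $v_i$, $0<i<m$, by a vertex $v_i'$ with $v_{i-1}\sim v_i'\sim v_{i+1}$. Two walks are equivalent if connected by finitely many prunes, inverse prunes and spider moves. $\Pi_v^v(G)$ is the group of equivalence classes of closed walks starting and ending at $v$, under concatenation. -}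

module Defs where

open import Data.Nat using (ℕ)
open import Data.Bool using (Bool; _xor_)
open import Data.Fin.Subset using (Subset; ∣_∣; _∩_; Empty)
open import Data.List using (List; []; _∷_; _++_)
open import Data.Product using (Σ; _×_; _,_; proj₁; proj₂)
open import Relation.Binary.PropositionalEquality using (_≡_; refl)
open import Relation.Binary.Construct.Closure.Equivalence using (EqClosure)

KVertex : ℕ → Set
KVertex n = Σ (Subset n) (λ s → ∣ s ∣ ≡ 2)

Adj : {n : ℕ} → KVertex n → KVertex n → Set
Adj (s , _) (t , _) = Empty (s ∩ t)

-- IsWalk x zs y : the vertex sequence (x ∷ zs) is a walk in K(n,2) ending at y.
IsWalk : {n : ℕ} → KVertex n → List (KVertex n) → KVertex n → Set
IsWalk x []       y = x ≡ y
IsWalk x (z ∷ zs) y = Adj x z × IsWalk z zs y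

Walk : {n : ℕ} → KVertex n → KVertex n → Set
Walk {n} x y = Σ (List (KVertex n)) (λ zs → IsWalk x zs y)

verts : {n : ℕ} {x y : KVertex n} → Walk x y → List (KVertex n)
verts {x = x} (zs , _) = x ∷ zs

data Move {A : Set} : List A → List A → Set where
  prune  : (xs ys : List A) (a b : A) →
           Move (xs ++ a ∷ b ∷ a ∷ ys) (xs ++ a ∷ ys)
  spider : (xs ys : List A) (a b b' c : A) →
           Move (xs ++ a ∷ b ∷ c ∷ ys) (xs ++ a ∷ b' ∷ c ∷ ys)

-- One move between two walks (both sides are walks, so adjacency of new
-- vertices is guaranteed by the walk structure).
WalkMove : {n : ℕ} {x y : KVertex n} → Walk x y → Walk x y → Set
WalkMove w w' = Move (verts w) (verts w')

_≈W_ : {n : ℕ} {x y : KVertex n} → Walk x y → Walk x y → Set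
_≈W_ = EqClosure WalkMove

isWalk-++ : {n : ℕ} {x y z : KVertex n} (zs ws : List (KVertex n)) →
            IsWalk x zs y → IsWalk y ws z → IsWalk x (zs ++ ws) z
isWalk-++ []       ws refl      q = q
isWalk-++ (u ∷ zs) ws (a , p)   q = a , isWalk-++ zs ws p q

_⊙_ : {n : ℕ} {x y z : KVertex n} → Walk x y → Walk y z → Walk x z
(zs , p) ⊙ (ws , q) = zs ++ ws , isWalk-++ zs ws p q

ClosedWalk : {n : ℕ} → KVertex n → Set
ClosedWalk v = Walk v v

-- Since Agda has no quotient types, Π_v^v ≅ ℤ/2 is expressed as a map
-- φ on closed walks that respects ≈W, is a homomorphism for concatenation,
-- is surjective, and whose fibres are exactly the ≈W-classes.
IsoToZ2 : {n : ℕ} (v : KVertex n) → (ClosedWalk v → Bool) → Set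
IsoToZ2 v φ =
    (∀ w w' → w ≈W w' → φ w ≡ φ w')
  × (∀ w w' → φ (w ⊙ w') ≡ (φ w xor φ w'))
  × (∀ w w' → φ w ≡ φ w' → w ≈W w')
  × (∀ b → Σ (ClosedWalk v) (λ w → φ w ≡ b))

PiIsoZ2 : {n : ℕ} (v : KVertex n) → Set
PiIsoZ2 v = Σ (ClosedWalk v → Bool) (IsoToZ2 v)

-- The parity of the number of edges is invariant under prunes and spider moves; this is
-- the homomorphism to ℤ/2. Conversely every walk is equivalent to one with two or three
-- edges: if the tail z ⋯ d of a walk a z ⋯ d has three edges, reroute it as z a m d
-- through a common neighbour m of a and d and prune a z a to a. Two-edge walks with the
-- same ends differ by one spider move, so everything rests on connecting any two
-- three-edge walks a b c d. If a and d are disjoint, spider c to a and prune. If they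
-- meet in one point, a = {p,q} and d = {p,r}, two spider moves bring the walk to the form
-- a {r,x} {q,y} d, and two such walks are joined by spider moves, via a point outside
-- {p,q,r,x,y} when one has the roles of x and y swapped.
-- If a = d, a detour v b c v x v exposes the three-edge walk b c v x between distinct
-- vertices. The hypothesis n ≥ 6 supplies the common neighbours and the extra point.
module Submission where

open import Defs

open import Data.Bool using (Bool; false; true; not; _xor_)
import Data.Bool as Bool
open import Data.Bool.Properties using (not-involutive; not-injective; not-distribˡ-xor)
open import Data.Empty using (⊥-elim)
open import Data.Fin using (Fin; zero; suc)
import Data.Fin.Properties as Fin
open import Data.Fin.Subset using (Subset; ∣_∣; _∈_; _∉_; _⊆_; _∪_; ⁅_⁆; ⊥; inside; outside)
open import Data.Fin.Subset.Properties
  using (x∈p∩q⁺; x∈p∩q⁻; x∈p∪q⁺; x∈p∪q⁻; x∈⁅x⁆; x∈⁅y⁆⇒x≡y; ∣⁅x⁆∣≡1; ∪-identityˡ; ∪-identityʳ; ⊆-antisym; _∈?_)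
open import Data.List using (List; []; _∷_; _++_; length; lookup)
open import Data.List.Membership.Propositional using () renaming (_∈_ to _∈ˡ_)
open import Data.List.Properties using (length-++; ++-assoc)
open import Data.List.Relation.Unary.All using (All; []; _∷_)
open import Data.List.Relation.Unary.All.Properties using (¬Any⇒All¬)
open import Data.List.Relation.Unary.Any using (index)
open import Data.List.Relation.Unary.Any.Properties using (lookup-index)
open import Data.Nat using (ℕ; zero; suc; _+_; _≤_; _<_; _≤?_; s≤s)
open import Data.Nat.Properties using (suc-injective; ≡-irrelevant; <⇒≱; ≤-trans)
open import Data.Product using (Σ; ∃; ∃₂; _×_; _,_; proj₁)
open import Data.Sum using (_⊎_; inj₁; inj₂; swap)
open import Data.Vec using ([]; _∷_)
open import Data.Vec.Properties using (≡-dec)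
open import Function using (_∘_; case_of_)
open import Relation.Binary.Construct.Closure.ReflexiveTransitive using (_◅◅_)
import Relation.Binary.Construct.Closure.Equivalence as EqClosure
open import Relation.Binary.Definitions using (DecidableEquality)
open import Relation.Binary.PropositionalEquality
  using (_≡_; _≢_; ≢-sym; refl; sym; trans; cong; subst; subst₂; isEquivalence)
open import Relation.Nullary using (¬?; yes; no; contradiction)
open import Relation.Nullary.Decidable using (True; toWitness; decidable-stable; map′)

private variable
  A : Set
  n : ℕ
  i j x : Fin n
  l l′ : List A
  a d u : KVertex n

-- Finite sets

∣p∣≡0⇒p≡⊥ : (p : Subset n) → ∣ p ∣ ≡ 0 → p ≡ ⊥
∣p∣≡0⇒p≡⊥ []            _     = refl
∣p∣≡0⇒p≡⊥ (outside ∷ p) ∣p∣≡0 = cong (outside ∷_) (∣p∣≡0⇒p≡⊥ p ∣p∣≡0)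

∣p∣≡1⇒p≡⁅i⁆ : (p : Subset n) → ∣ p ∣ ≡ 1 → ∃ λ i → p ≡ ⁅ i ⁆
∣p∣≡1⇒p≡⁅i⁆ (inside ∷ p)  ∣p∣≡1 = zero , cong (inside ∷_) (∣p∣≡0⇒p≡⊥ p (suc-injective ∣p∣≡1))
∣p∣≡1⇒p≡⁅i⁆ (outside ∷ p) ∣p∣≡1 with ∣p∣≡1⇒p≡⁅i⁆ p ∣p∣≡1
... | i , refl = suc i , refl

∣p∣≡2⇒p≡⁅i⁆∪⁅j⁆ : (p : Subset n) → ∣ p ∣ ≡ 2 → ∃₂ λ i j → i ≢ j × p ≡ ⁅ i ⁆ ∪ ⁅ j ⁆
∣p∣≡2⇒p≡⁅i⁆∪⁅j⁆ (inside ∷ p) ∣p∣≡2 with ∣p∣≡1⇒p≡⁅i⁆ p (suc-injective ∣p∣≡2)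
... | j , refl = zero , suc j , (λ ()) , cong (inside ∷_) (sym (∪-identityˡ ⁅ j ⁆))
∣p∣≡2⇒p≡⁅i⁆∪⁅j⁆ (outside ∷ p) ∣p∣≡2 with ∣p∣≡2⇒p≡⁅i⁆∪⁅j⁆ p ∣p∣≡2
... | i , j , i≢j , refl = suc i , suc j , i≢j ∘ Fin.suc-injective , refl

∣⁅i⁆∪⁅j⁆∣≡2 : (i j : Fin n) → i ≢ j → ∣ ⁅ i ⁆ ∪ ⁅ j ⁆ ∣ ≡ 2
∣⁅i⁆∪⁅j⁆∣≡2 zero    zero    i≢j = ⊥-elim (i≢j refl)
∣⁅i⁆∪⁅j⁆∣≡2 zero    (suc j) _   = cong suc (subst (λ s → ∣ s ∣ ≡ 1) (sym (∪-identityˡ ⁅ j ⁆)) (∣⁅x⁆∣≡1 j))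
∣⁅i⁆∪⁅j⁆∣≡2 (suc i) zero    _   = cong suc (subst (λ s → ∣ s ∣ ≡ 1) (sym (∪-identityʳ ⁅ i ⁆)) (∣⁅x⁆∣≡1 i))
∣⁅i⁆∪⁅j⁆∣≡2 (suc i) (suc j) i≢j = ∣⁅i⁆∪⁅j⁆∣≡2 i j (i≢j ∘ cong suc)

module _ {n : ℕ} where
  open import Data.List.Membership.DecPropositional (Fin._≟_ {n}) using () renaming (_∈?_ to _∈ˡ?_)

  fresh : (xs : List (Fin n)) → length xs < n → ∃ λ k → All (k ≢_) xs
  fresh xs |xs|<n with Fin.any? (λ k → ¬? (k ∈ˡ? xs))
  ... | yes (k , k∉xs) = k , ¬Any⇒All¬ xs k∉xs
  ... | no ∄k∉xs = ⊥-elim (<⇒≱ |xs|<n (Fin.injective⇒≤ index-injective))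
    where
    ∈xs : ∀ k → k ∈ˡ xs
    ∈xs k = decidable-stable (k ∈ˡ? xs) (λ k∉xs → ∄k∉xs (k , k∉xs))
    index-injective : ∀ {k l} → index (∈xs k) ≡ index (∈xs l) → k ≡ l
    index-injective {k} {l} eq =
      trans (lookup-index (∈xs k)) (trans (cong (lookup xs) eq) (sym (lookup-index (∈xs l))))

-- Vertices of K(n,2)

_∈ᵛ_ : Fin n → KVertex n → Set
i ∈ᵛ v = i ∈ proj₁ v

_∉ᵛ_ : Fin n → KVertex n → Set
i ∉ᵛ v = i ∉ proj₁ v

Adj-intro : (u v : KVertex n) → (∀ {i} → i ∈ᵛ u → i ∉ᵛ v) → Adj u v
Adj-intro (s , _) (t , _) disj (i , i∈s∩t) with x∈p∩q⁻ s t i∈s∩t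
... | i∈s , i∈t = disj i∈s i∈t

Adj-elim : (u v : KVertex n) → Adj u v → i ∈ᵛ u → i ∉ᵛ v
Adj-elim {i = i} u v uv i∈u i∈v = uv (i , x∈p∩q⁺ (i∈u , i∈v))

Adj-sym : (u v : KVertex n) → Adj u v → Adj v u
Adj-sym u v uv = Adj-intro v u λ i∈v i∈u → Adj-elim u v uv i∈u i∈v

pair : (i j : Fin n) → i ≢ j → KVertex n
pair i j i≢j = ⁅ i ⁆ ∪ ⁅ j ⁆ , ∣⁅i⁆∪⁅j⁆∣≡2 i j i≢j

module _ {i j : Fin n} where

  ∈-pairˡ : i ∈ ⁅ i ⁆ ∪ ⁅ j ⁆
  ∈-pairˡ = x∈p∪q⁺ (inj₁ (x∈⁅x⁆ i))

  ∈-pairʳ : j ∈ ⁅ i ⁆ ∪ ⁅ j ⁆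
  ∈-pairʳ = x∈p∪q⁺ (inj₂ (x∈⁅x⁆ j))

  ∈-pair⁻ : x ∈ ⁅ i ⁆ ∪ ⁅ j ⁆ → x ≡ i ⊎ x ≡ j
  ∈-pair⁻ x∈ with x∈p∪q⁻ ⁅ i ⁆ ⁅ j ⁆ x∈
  ... | inj₁ x∈⁅i⁆ = inj₁ (x∈⁅y⁆⇒x≡y i x∈⁅i⁆)
  ... | inj₂ x∈⁅j⁆ = inj₂ (x∈⁅y⁆⇒x≡y j x∈⁅j⁆)

  ∉-pair : x ≢ i → x ≢ j → x ∉ ⁅ i ⁆ ∪ ⁅ j ⁆
  ∉-pair x≢i x≢j x∈ with ∈-pair⁻ x∈
  ... | inj₁ x≡i = x≢i x≡i
  ... | inj₂ x≡j = x≢j x≡j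

vertex-≡ : (u v : KVertex n) → proj₁ u ≡ proj₁ v → u ≡ v
vertex-≡ (s , ∣s∣≡2) (.s , ∣s∣≡2′) refl = cong (s ,_) (≡-irrelevant ∣s∣≡2 ∣s∣≡2′)

vertex-is-pair : (v : KVertex n) → ∃₂ λ i j → Σ (i ≢ j) λ i≢j → v ≡ pair i j i≢j
vertex-is-pair v@(s , ∣s∣≡2) with ∣p∣≡2⇒p≡⁅i⁆∪⁅j⁆ s ∣s∣≡2
... | i , j , i≢j , refl = i , j , i≢j , vertex-≡ v (pair i j i≢j) refl

elements : (v : KVertex n) → ∃₂ λ i j → i ≢ j × i ∈ᵛ v × j ∈ᵛ v
elements v with vertex-is-pair v
... | i , j , i≢j , refl = i , j , i≢j , ∈-pairˡ , ∈-pairʳ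

∈ᵛ-two : (v : KVertex n) → i ∈ᵛ v → j ∈ᵛ v → i ≢ j → x ∈ᵛ v → x ≡ i ⊎ x ≡ j
∈ᵛ-two v i∈v j∈v i≢j x∈v with vertex-is-pair v
... | _ , _ , _ , refl with ∈-pair⁻ i∈v | ∈-pair⁻ j∈v
...   | inj₁ refl | inj₁ refl = ⊥-elim (i≢j refl)
...   | inj₂ refl | inj₂ refl = ⊥-elim (i≢j refl)
...   | inj₁ refl | inj₂ refl = ∈-pair⁻ x∈v
...   | inj₂ refl | inj₁ refl = swap (∈-pair⁻ x∈v)

∉ᵛ-third : (v : KVertex n) → i ∈ᵛ v → j ∈ᵛ v → i ≢ j → x ≢ i → x ≢ j → x ∉ᵛ v
∉ᵛ-third v i∈v j∈v i≢j x≢i x≢j x∈v with ∈ᵛ-two v i∈v j∈v i≢j x∈v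
... | inj₁ x≡i = x≢i x≡i
... | inj₂ x≡j = x≢j x≡j

⊆-by-two-elements : (u v : KVertex n) → i ≢ j → i ∈ᵛ u → j ∈ᵛ u → i ∈ᵛ v → j ∈ᵛ v → proj₁ u ⊆ proj₁ v
⊆-by-two-elements u v i≢j i∈u j∈u i∈v j∈v x∈u with ∈ᵛ-two u i∈u j∈u i≢j x∈u
... | inj₁ refl = i∈v
... | inj₂ refl = j∈v

≡-by-two-elements : (u v : KVertex n) → i ≢ j → i ∈ᵛ u → j ∈ᵛ u → i ∈ᵛ v → j ∈ᵛ v → u ≡ v
≡-by-two-elements u v i≢j i∈u j∈u i∈v j∈v =
  vertex-≡ u v (⊆-antisym (⊆-by-two-elements u v i≢j i∈u j∈u i∈v j∈v)
                          (⊆-by-two-elements v u i≢j i∈v j∈v i∈u j∈u))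

Adj-from-elements : (u v : KVertex n) → i ∈ᵛ u → j ∈ᵛ u → i ≢ j → i ∉ᵛ v → j ∉ᵛ v → Adj u v
Adj-from-elements u v i∈u j∈u i≢j i∉v j∉v = Adj-intro u v λ x∈u → case ∈ᵛ-two u i∈u j∈u i≢j x∈u of λ where
  (inj₁ refl) → i∉v
  (inj₂ refl) → j∉v

pair-Adj : (i≢j : i ≢ j) (v : KVertex n) → i ∉ᵛ v → j ∉ᵛ v → Adj (pair i j i≢j) v
pair-Adj i≢j v = Adj-from-elements (pair _ _ i≢j) v ∈-pairˡ ∈-pairʳ i≢j

Adj-pair : (i≢j : i ≢ j) (v : KVertex n) → i ∉ᵛ v → j ∉ᵛ v → Adj v (pair i j i≢j)
Adj-pair i≢j v i∉v j∉v = Adj-sym (pair _ _ i≢j) v (pair-Adj i≢j v i∉v j∉v)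

other-element : (v : KVertex n) (e : Fin n) → ∃ λ o → o ∈ᵛ v × o ≢ e
other-element v e with elements v
... | i , j , i≢j , i∈v , j∈v with i Fin.≟ e
...   | yes refl = j , j∈v , i≢j ∘ sym
...   | no i≢e   = i , i∈v , i≢e

_≟ᵛ_ : DecidableEquality (KVertex n)
u ≟ᵛ v = map′ (vertex-≡ u v) (cong proj₁) (≡-dec Bool._≟_ (proj₁ u) (proj₁ v))

∉-∈⇒≢ : (v : KVertex n) → i ∉ᵛ v → j ∈ᵛ v → i ≢ j
∉-∈⇒≢ v i∉v j∈v refl = i∉v j∈v

record ShareOnePoint (a d : KVertex n) : Set where
  field
    p q r : Fin n
    p∈a : p ∈ᵛ a
    q∈a : q ∈ᵛ a
    p∈d : p ∈ᵛ d
    r∈d : r ∈ᵛ d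
    p≢q : p ≢ q
    p≢r : p ≢ r
    q≢r : q ≢ r

shareOnePoint : (a d : KVertex n) → i ∈ᵛ a → j ∈ᵛ a → i ≢ j → i ∈ᵛ d → j ∉ᵛ d → ShareOnePoint a d
shareOnePoint {i = i} {j = j} a d i∈a j∈a i≢j i∈d j∉d with other-element d i
... | k , k∈d , k≢i = record
  { p = i ; q = j ; r = k ; p∈a = i∈a ; q∈a = j∈a ; p∈d = i∈d ; r∈d = k∈d
  ; p≢q = i≢j ; p≢r = ≢-sym k≢i ; q≢r = ∉-∈⇒≢ d j∉d k∈d }

trichotomy : (a d : KVertex n) → Adj a d ⊎ ShareOnePoint a d ⊎ a ≡ d
trichotomy a d with elements a
... | i , j , i≢j , i∈a , j∈a with i ∈? proj₁ d | j ∈? proj₁ d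
...   | no i∉d  | no j∉d  = inj₁ (Adj-from-elements a d i∈a j∈a i≢j i∉d j∉d)
...   | yes i∈d | no j∉d  = inj₂ (inj₁ (shareOnePoint a d i∈a j∈a i≢j i∈d j∉d))
...   | no i∉d  | yes j∈d = inj₂ (inj₁ (shareOnePoint a d j∈a i∈a (≢-sym i≢j) j∈d i∉d))
...   | yes i∈d | yes j∈d = inj₂ (inj₂ (≡-by-two-elements a d i≢j i∈a j∈a i∈d j∈d))

-- Walks, moves and parity

Move-∷ : (x : A) → Move l l′ → Move (x ∷ l) (x ∷ l′)
Move-∷ x (prune xs ys a b)         = prune (x ∷ xs) ys a b
Move-∷ x (spider xs ys a b b′ c)   = spider (x ∷ xs) ys a b b′ c

Move-++ʳ : (r : List A) → Move l l′ → Move (l ++ r) (l′ ++ r)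
Move-++ʳ r (prune xs ys a b) =
  subst₂ Move (sym (++-assoc xs (a ∷ b ∷ a ∷ ys) r)) (sym (++-assoc xs (a ∷ ys) r))
         (prune xs (ys ++ r) a b)
Move-++ʳ r (spider xs ys a b b′ c) =
  subst₂ Move (sym (++-assoc xs (a ∷ b ∷ c ∷ ys) r)) (sym (++-assoc xs (a ∷ b′ ∷ c ∷ ys) r))
         (spider xs (ys ++ r) a b b′ c)

odd : ℕ → Bool
odd zero    = false
odd (suc m) = not (odd m)

odd-+ : ∀ m k → odd (m + k) ≡ odd m xor odd k
odd-+ zero    k = refl
odd-+ (suc m) k = trans (cong not (odd-+ m k)) (not-distribˡ-xor (odd m) (odd k))

odd-length-++ˡ : (xs : List A) {ys ys′ : List A} → odd (length ys) ≡ odd (length ys′) →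
                 odd (length (xs ++ ys)) ≡ odd (length (xs ++ ys′))
odd-length-++ˡ []       eq = eq
odd-length-++ˡ (x ∷ xs) eq = cong not (odd-length-++ˡ xs eq)

odd-length-Move : Move l l′ → odd (length l) ≡ odd (length l′)
odd-length-Move (prune xs ys a b)       = odd-length-++ˡ xs (not-involutive _)
odd-length-Move (spider xs ys a b b′ c) = odd-length-++ˡ xs refl

-- zs lists the vertices after the start, so its length is the number of edges.
oddLength : {x y : KVertex n} → Walk x y → Bool
oddLength (zs , _) = odd (length zs)

oddLength-≈ : {x y : KVertex n} {w w′ : Walk x y} → w ≈W w′ → oddLength w ≡ oddLength w′
oddLength-≈ = EqClosure.gfold isEquivalence oddLength (not-injective ∘ odd-length-Move)

oddLength-⊙ : {x y z : KVertex n} (w : Walk x y) (w′ : Walk y z) →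
              oddLength (w ⊙ w′) ≡ oddLength w xor oddLength w′
oddLength-⊙ (zs , _) (ws , _) = trans (cong odd (length-++ zs)) (odd-+ (length zs) (length ws))

≈-sym : {x y : KVertex n} {w w′ : Walk x y} → w ≈W w′ → w′ ≈W w
≈-sym = EqClosure.symmetric WalkMove

by-move : {x y : KVertex n} {w w′ : Walk x y} → Move (verts w) (verts w′) → w ≈W w′
by-move = EqClosure.return

edge : Adj a d → Walk a d
edge {d = d} ad = d ∷ [] , ad , refl

_◃_ : Adj a u → Walk u d → Walk a d
_◃_ {u = u} au (zs , w) = u ∷ zs , au , w

◃-cong : {a u d : KVertex n} (au : Adj a u) {w w′ : Walk u d} → w ≈W w′ → (au ◃ w) ≈W (au ◃ w′)
◃-cong {a = a} {u = u} au = EqClosure.gmap (_◃_ {u = u} au) (Move-∷ a)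

⊙-congˡ : (r : Walk u d) {w w′ : Walk a u} → w ≈W w′ → (w ⊙ r) ≈W (w′ ⊙ r)
⊙-congˡ (rs , _) = EqClosure.gmap (_⊙ _) (Move-++ʳ rs)

record Path₂ (a d : KVertex n) : Set where
  constructor path₂
  field
    b  : KVertex n
    ab : Adj a b
    bd : Adj b d

record Path₃ (a d : KVertex n) : Set where
  constructor path₃
  field
    b c : KVertex n
    ab  : Adj a b
    bc  : Adj b c
    cd  : Adj c d

⟦_⟧₂ : Path₂ a d → Walk a d
⟦ path₂ b ab bd ⟧₂ = ab ◃ edge {a = b} bd

⟦_⟧₃ : Path₃ a d → Walk a d
⟦ path₃ b c ab bc cd ⟧₃ = _◃_ {u = b} ab (bc ◃ edge {a = c} cd)

path₂-connected : (p q : Path₂ a d) → ⟦ p ⟧₂ ≈W ⟦ q ⟧₂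
path₂-connected {a = a} {d = d} (path₂ b _ _) (path₂ b′ _ _) = by-move (spider [] [] a b b′ d)

path₃≈edge : {a d : KVertex n} (ad : Adj a d) (π : Path₃ a d) → ⟦ π ⟧₃ ≈W edge ad
path₃≈edge {a = a} {d = d} ad (path₃ b c ab bc cd) = move-c ◅◅ by-move (prune [] (d ∷ []) a b)
  where
  move-c : ⟦ path₃ b c ab bc cd ⟧₃ ≈W ⟦ path₃ b a ab (Adj-sym a b ab) ad ⟧₃
  move-c = by-move (spider (a ∷ []) [] b c a d)

-- Equivalence of walks when n ≥ 6

module _ {n : ℕ} (6≤n : 6 ≤ n) where

  fresh≤5 : (xs : List (Fin n)) → {True (length xs ≤? 5)} → ∃ λ k → All (k ≢_) xs
  fresh≤5 xs {|xs|≤5} = fresh xs (≤-trans (s≤s (toWitness |xs|≤5)) 6≤n)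

  common-neighbour : (a d : KVertex n) → ∃ λ u → Adj a u × Adj u d
  common-neighbour a d with elements a | elements d
  ... | a₁ , a₂ , a₁≢a₂ , a₁∈a , a₂∈a | d₁ , d₂ , d₁≢d₂ , d₁∈d , d₂∈d
    with fresh≤5 (a₁ ∷ a₂ ∷ d₁ ∷ d₂ ∷ [])
  ... | f , f≢a₁ ∷ f≢a₂ ∷ f≢d₁ ∷ f≢d₂ ∷ []
    with fresh≤5 (f ∷ a₁ ∷ a₂ ∷ d₁ ∷ d₂ ∷ [])
  ... | g , g≢f ∷ g≢a₁ ∷ g≢a₂ ∷ g≢d₁ ∷ g≢d₂ ∷ [] =
    pair f g (≢-sym g≢f) ,
    Adj-pair (≢-sym g≢f) a (∉a f≢a₁ f≢a₂) (∉a g≢a₁ g≢a₂) ,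
    pair-Adj (≢-sym g≢f) d (∉d f≢d₁ f≢d₂) (∉d g≢d₁ g≢d₂)
    where
    ∉a : ∀ {x} → x ≢ a₁ → x ≢ a₂ → x ∉ᵛ a
    ∉a = ∉ᵛ-third a a₁∈a a₂∈a a₁≢a₂
    ∉d : ∀ {x} → x ≢ d₁ → x ≢ d₂ → x ∉ᵛ d
    ∉d = ∉ᵛ-third d d₁∈d d₂∈d d₁≢d₂

  module OnePoint {a d : KVertex n} (s : ShareOnePoint a d) where
    open ShareOnePoint s

    r∉a : r ∉ᵛ a
    r∉a = ∉ᵛ-third a p∈a q∈a p≢q (≢-sym p≢r) (≢-sym q≢r)

    q∉d : q ∉ᵛ d
    q∉d = ∉ᵛ-third d p∈d r∈d p≢r (≢-sym p≢q) q≢r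

    Outside : Set
    Outside = Σ (Fin n) λ x → x ≢ p × x ≢ q × x ≢ r

    standard : (x y : Outside) → proj₁ x ≢ proj₁ y → Path₃ a d
    standard (x , x≢p , x≢q , x≢r) (y , y≢p , y≢q , y≢r) x≢y =
      path₃ (pair r x (≢-sym x≢r)) (pair q y (≢-sym y≢q))
        (Adj-pair (≢-sym x≢r) a r∉a (∉ᵛ-third a p∈a q∈a p≢q x≢p x≢q))
        (pair-Adj (≢-sym x≢r) (pair q y (≢-sym y≢q)) (∉-pair (≢-sym q≢r) (≢-sym y≢r)) (∉-pair x≢q x≢y))
        (pair-Adj (≢-sym y≢q) d q∉d (∉ᵛ-third d p∈d r∈d p≢r y≢p y≢r))

    standard-≈ˡ : (x x′ y : Outside) (x≢y : proj₁ x ≢ proj₁ y) (x′≢y : proj₁ x′ ≢ proj₁ y) →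
                  ⟦ standard x y x≢y ⟧₃ ≈W ⟦ standard x′ y x′≢y ⟧₃
    standard-≈ˡ _ _ _ _ _ = by-move (spider [] _ _ _ _ _)

    standard-≈ʳ : (x y y′ : Outside) (x≢y : proj₁ x ≢ proj₁ y) (x≢y′ : proj₁ x ≢ proj₁ y′) →
                  ⟦ standard x y x≢y ⟧₃ ≈W ⟦ standard x y′ x≢y′ ⟧₃
    standard-≈ʳ _ _ _ _ _ = by-move (spider (a ∷ []) _ _ _ _ _)

    standard-connected : (x y x′ y′ : Outside) (x≢y : proj₁ x ≢ proj₁ y) (x′≢y′ : proj₁ x′ ≢ proj₁ y′) →
                         ⟦ standard x y x≢y ⟧₃ ≈W ⟦ standard x′ y′ x′≢y′ ⟧₃
    standard-connected x y x′ y′ x≢y x′≢y′ with proj₁ x′ Fin.≟ proj₁ y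
    ... | no x′≢y = standard-≈ˡ x x′ y x≢y x′≢y ◅◅ standard-≈ʳ x′ y y′ x′≢y x′≢y′
    ... | yes _ with proj₁ y′ Fin.≟ proj₁ x
    ...   | no y′≢x = standard-≈ʳ x y y′ x≢y (≢-sym y′≢x) ◅◅ standard-≈ˡ x x′ y′ (≢-sym y′≢x) x′≢y′
    ...   | yes y′≡x with fresh≤5 (p ∷ q ∷ r ∷ proj₁ x ∷ proj₁ y ∷ [])
    ...     | z , z≢p ∷ z≢q ∷ z≢r ∷ z≢x ∷ z≢y ∷ [] =
      standard-≈ˡ x z′ y x≢y z≢y ◅◅ standard-≈ʳ z′ y y′ z≢y z≢y′ ◅◅ standard-≈ˡ z′ x′ y′ z≢y′ x′≢y′
      where
      z′ : Outside
      z′ = z , z≢p , z≢q , z≢r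
      z≢y′ : z ≢ proj₁ y′
      z≢y′ = subst (z ≢_) (sym y′≡x) z≢x

    ≈standard : (π : Path₃ a d) → ∃₂ λ x y → Σ (proj₁ x ≢ proj₁ y) λ x≢y → ⟦ π ⟧₃ ≈W ⟦ standard x y x≢y ⟧₃
    ≈standard (path₃ b c ab bc cd) with other-element b r | other-element c q
    ... | x , x∈b , x≢r | y , y∈c , y≢q =
      x′ , y′ , x≢y , move-b ◅◅ by-move (spider (a ∷ []) [] _ c _ d)
      where
      x∉a : x ∉ᵛ a
      x∉a = Adj-elim b a (Adj-sym a b ab) x∈b
      x∉c : x ∉ᵛ c
      x∉c = Adj-elim b c bc x∈b
      y∉d : y ∉ᵛ d
      y∉d = Adj-elim c d cd y∈c
      x′ : Outside
      x′ = x , ∉-∈⇒≢ a x∉a p∈a , ∉-∈⇒≢ a x∉a q∈a , x≢r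
      y′ : Outside
      y′ = y , ∉-∈⇒≢ d y∉d p∈d , y≢q , ∉-∈⇒≢ d y∉d r∈d
      x≢y : x ≢ y
      x≢y = ∉-∈⇒≢ c x∉c y∈c
      rx∼c : Adj (pair r x (≢-sym x≢r)) c
      rx∼c = pair-Adj (≢-sym x≢r) c (Adj-elim d c (Adj-sym c d cd) r∈d) x∉c
      move-b : ⟦ path₃ b c ab bc cd ⟧₃ ≈W ⟦ path₃ _ c (Path₃.ab (standard x′ y′ x≢y)) rx∼c cd ⟧₃
      move-b = by-move (spider [] (d ∷ []) a b _ c)

    path₃-connected : (π π′ : Path₃ a d) → ⟦ π ⟧₃ ≈W ⟦ π′ ⟧₃
    path₃-connected π π′ with ≈standard π | ≈standard π′
    ... | x , y , x≢y , π≈ | x′ , y′ , x′≢y′ , π′≈ =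
      π≈ ◅◅ standard-connected x y x′ y′ x≢y x′≢y′ ◅◅ ≈-sym π′≈

  path₃-connected-≢ : {a d : KVertex n} → a ≢ d → (π π′ : Path₃ a d) → ⟦ π ⟧₃ ≈W ⟦ π′ ⟧₃
  path₃-connected-≢ {a} {d} a≢d π π′ with trichotomy a d
  ... | inj₁ ad        = path₃≈edge ad π ◅◅ ≈-sym (path₃≈edge ad π′)
  ... | inj₂ (inj₁ s)  = OnePoint.path₃-connected s π π′
  ... | inj₂ (inj₂ a≡d) = ⊥-elim (a≢d a≡d)

  -- v b c v ≈ v b c v x v ≈ v b v y x v ≈ v y x v, rerouting b c v x as b v y x.
  triangle-swap : {v : KVertex n} (π π′ : Path₃ v v) → Path₃.b π ≢ Path₃.c π′ → ⟦ π ⟧₃ ≈W ⟦ π′ ⟧₃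
  triangle-swap {v} (path₃ b c vb bc cv) (path₃ y x vy yx xv) b≢x =
    ≈-sym (by-move (prune (v ∷ b ∷ c ∷ []) [] v x)) ◅◅
    ◃-cong vb (⊙-congˡ (edge xv) (path₃-connected-≢ b≢x (path₃ c v bc cv vx) (path₃ v y bv vy yx))) ◅◅
    by-move (prune [] (y ∷ x ∷ v ∷ []) v b)
    where
    vx = Adj-sym x v xv
    bv = Adj-sym v b vb

  triangles-connected : {v : KVertex n} (π π′ : Path₃ v v) → ⟦ π ⟧₃ ≈W ⟦ π′ ⟧₃
  triangles-connected π π′ with Path₃.b π ≟ᵛ Path₃.c π′
  ... | no b≢c′ = triangle-swap π π′ b≢c′
  triangles-connected {v} π@(path₃ b c vb bc cv) π′ | yes refl
    with elements b | elements c
  ... | b₁ , b₂ , b₁≢b₂ , b₁∈b , b₂∈b | c₁ , c₂ , c₁≢c₂ , c₁∈c , c₂∈c =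
    triangle-swap π crossing (λ { refl → c∉b c₁∈c ∈-pairʳ }) ◅◅
    triangle-swap crossing π′ (λ { refl → c∉b c₂∈c ∈-pairʳ })
    where
    b≢c : ∀ {x y} → x ∈ᵛ b → y ∈ᵛ c → x ≢ y
    b≢c x∈b = ∉-∈⇒≢ c (Adj-elim b c bc x∈b)
    c∉b : ∀ {x} → x ∈ᵛ c → x ∉ᵛ b
    c∉b = Adj-elim c b (Adj-sym b c bc)
    b∉v : ∀ {x} → x ∈ᵛ b → x ∉ᵛ v
    b∉v = Adj-elim b v (Adj-sym v b vb)
    c∉v : ∀ {x} → x ∈ᵛ c → x ∉ᵛ v
    c∉v = Adj-elim c v cv
    -- neither inner vertex of this triangle is b
    crossing : Path₃ v v
    crossing =
      path₃ (pair b₂ c₂ b₂≢c₂) (pair b₁ c₁ b₁≢c₁)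
        (Adj-pair b₂≢c₂ v (b∉v b₂∈b) (c∉v c₂∈c))
        (pair-Adj b₂≢c₂ (pair b₁ c₁ b₁≢c₁) (∉-pair (≢-sym b₁≢b₂) (b≢c b₂∈b c₁∈c))
                                          (∉-pair (≢-sym (b≢c b₁∈b c₂∈c)) (≢-sym c₁≢c₂)))
        (pair-Adj b₁≢c₁ v (b∉v b₁∈b) (c∉v c₁∈c))
      where
      b₁≢c₁ = b≢c b₁∈b c₁∈c
      b₂≢c₂ = b≢c b₂∈b c₂∈c

  path₃-connected : {a d : KVertex n} (π π′ : Path₃ a d) → ⟦ π ⟧₃ ≈W ⟦ π′ ⟧₃
  path₃-connected {a} {d} π π′ with a ≟ᵛ d
  ... | yes refl = triangles-connected π π′
  ... | no a≢d   = path₃-connected-≢ a≢d π π′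

  shorten : {a u d : KVertex n} (au : Adj a u) (π : Path₃ u d) → ∃ λ σ → (au ◃ ⟦ π ⟧₃) ≈W ⟦ σ ⟧₂
  shorten {a} {u} {d} au π with common-neighbour a d
  ... | m , am , md =
    path₂ m am md ,
    ◃-cong au (path₃-connected π (path₃ a m (Adj-sym a u au) am md)) ◅◅ by-move (prune [] (m ∷ d ∷ []) a u)

  normalise : {a d : KVertex n} (zs : List (KVertex n)) (t : IsWalk a zs d) →
              (∃ λ σ → (zs , t) ≈W ⟦ σ ⟧₂) ⊎ (∃ λ π → (zs , t) ≈W ⟦ π ⟧₃)
  normalise {a} [] refl with common-neighbour a a
  ... | m , am , ma = inj₁ (path₂ m am ma , ≈-sym (by-move (prune [] [] a m)))
  normalise (z ∷ zs) (az , t) with normalise zs t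
  ... | inj₁ (path₂ m zm md , t≈σ) = inj₂ (path₃ z m az zm md , ◃-cong az t≈σ)
  ... | inj₂ (π , t≈π) with shorten az π
  ...   | σ , az◃π≈σ = inj₁ (σ , ◃-cong az t≈π ◅◅ az◃π≈σ)

  ≈W-by-oddLength : {a d : KVertex n} (w w′ : Walk a d) → oddLength w ≡ oddLength w′ → w ≈W w′
  ≈W-by-oddLength (zs , t) (zs′ , t′) eq with normalise zs t | normalise zs′ t′
  ... | inj₁ (σ , w≈σ) | inj₁ (σ′ , w′≈σ′) = w≈σ ◅◅ path₂-connected σ σ′ ◅◅ ≈-sym w′≈σ′
  ... | inj₂ (π , w≈π) | inj₂ (π′ , w′≈π′) = w≈π ◅◅ path₃-connected π π′ ◅◅ ≈-sym w′≈π′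
  ... | inj₁ (σ , w≈σ) | inj₂ (π′ , w′≈π′) =
    contradiction (trans (sym (oddLength-≈ w≈σ)) (trans eq (oddLength-≈ w′≈π′))) λ ()
  ... | inj₂ (π , w≈π) | inj₁ (σ′ , w′≈σ′) =
    contradiction (trans (sym (oddLength-≈ w≈π)) (trans eq (oddLength-≈ w′≈σ′))) λ ()

  triangle : (v : KVertex n) → Path₃ v v
  triangle v with common-neighbour v v
  ... | b , vb , _ with common-neighbour b v
  ...   | c , bc , cv = path₃ b c vb bc cv

proposition4p23 : (n : ℕ) → 6 ≤ n → (v : KVertex n) → PiIsoZ2 v
proposition4p23 n 6≤n v =
  oddLength , (λ _ _ → oddLength-≈) , oddLength-⊙ , ≈W-by-oddLength 6≤n , surjective
  where
  surjective : ∀ b → Σ (ClosedWalk v) λ w → oddLength w ≡ b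
  surjective false = ([] , refl) , refl
  surjective true  = ⟦ triangle 6≤n v ⟧₃ , refl
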